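{- Let $n\ge m\ge 3$ and $k\ge 1$ be integers and let $e_1,\dots,e_k\ge 0$ be integers with $\sum_{i=1}^k e_i=\binom n2$ and \[\sum_{i=1}^k\binom{e_i}{2}<\frac{n(n-1)(n-2)}{m(m-1)(m-2)}.\] Then every edge colouring of $K_n$ in which exactly $e_i$ edges have colour $i$ for each $i\in[k]$ contains a rainbow copy of $K_m$.
   Context: A rainbow copy of $K_m$ is a set of $m$ vertices all of whose $\binom m2$ connecting edges have pairwise distinct colours. -}

module Defs where

open import Data.Nat using (ℕ; zero; suc; _+_; _*_)
open import Data.Fin using (Fin)
import Data.Fin
open import Data.Fin.Properties using (_≟_)
open import Data.List using (List; []; _∷_; filter; length; allFin; concatMap)
open import Data.List.Membership.Propositional using (_∈_)
open import Data.Product using (_×_; _,_; Σ)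
open import Relation.Binary.PropositionalEquality using (_≡_)
open import Relation.Nullary using (¬_)
open import Data.Fin.Properties using (_<?_)
open import Function.Definitions using (Injective)

∑ : {k : ℕ} → (Fin k → ℕ) → ℕ
∑ {zero} f = 0
∑ {suc k} f = f Data.Fin.zero + ∑ (λ i → f (Data.Fin.suc i))

-- An edge colouring of K_n with colours in [k] = Fin k:
-- a symmetric function on pairs of distinct vertices (diagonal values are irrelevant).
record EdgeColouring (n k : ℕ) : Set where
  field
    col : Fin n → Fin n → Fin k
    sym : ∀ u v → col u v ≡ col v u
open EdgeColouring public

edges : (n : ℕ) → List (Fin n × Fin n)
edges n = concatMap (λ u → concatMap (λ v → pairIf u v) (allFin n)) (allFin n)
  where
    pairIf : Fin n → Fin n → List (Fin n × Fin n)
    pairIf u v with u <? v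
    ... | Relation.Nullary.yes _ = (u , v) ∷ []
    ... | Relation.Nullary.no _ = []

colourCount : {n k : ℕ} → EdgeColouring n k → Fin k → ℕ
colourCount {n} c i =
  length (filter (λ e → col c (Data.Product.proj₁ e) (Data.Product.proj₂ e) ≟ i) (edges n))

Rainbow : {n k : ℕ} → EdgeColouring n k → (m : ℕ) → Set
Rainbow {n} c m =
  Σ (Fin m → Fin n) λ f →
    Injective _≡_ _≡_ f ×
    (∀ a b a' b' → a Data.Fin.< b → a' Data.Fin.< b' →
       col c (f a) (f b) ≡ col c (f a') (f b') → (a ≡ a') × (b ≡ b'))

-- Call a clash an ordered pair of distinct edges of the same colour, so a colouring whose colour
-- classes have sizes eᵢ has 2 ∑ C(eᵢ,2) clashes. Two distinct edges span at least three vertices,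
-- hence for a colouring on s vertices the clashes that survive deleting v, summed over all v, number
-- at most (s − 3) times the clashes; deleting the best vertex does not increase
-- clashes / (s (s − 1) (s − 2)). Deleting vertices down to m of them, each deletion being a
-- restriction along punchIn, leaves fewer than 2 clashes. Clashes come in symmetric pairs, so none
-- is left: the remaining m vertices span a rainbow Kₘ.

module Submission where

open import Data.Fin as Fin using (Fin; zero; suc; punchIn; punchOut)
open import Data.Fin.Properties
  using (_≟_; _<?_; punchInᵢ≢i; punchIn-punchOut; punchIn-injective)
import Data.Fin.Properties as Finₚ
open import Data.List using (List; _++_; length; filter; concatMap; tabulate; allFin)
open import Data.List.Properties using (length-++; filter-++)
open import Data.Nat using (ℕ; zero; suc; _+_; _*_; _∸_; _≤_; _<_; _≤?_; z≤n; s≤s)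
open import Data.Nat.Combinatorics using (_C_; nC1≡n; nCk+nC[k+1]≡[n+1]C[k+1])
open import Data.Nat.Properties
  using (≤-refl; ≤-trans; ≤-reflexive; <⇒≤; ≰⇒>; <⇒≱; m≤n⇒m<n∨m≡n; m≤m+n; m+n∸n≡m;
         +-identityʳ; +-comm; +-cancelʳ-≡; +-mono-≤; +-monoʳ-≤;
         *-identityˡ; *-identityʳ; *-zeroʳ; *-assoc; *-comm; *-distribˡ-+;
         *-monoˡ-≤; *-monoʳ-≤; *-monoʳ-<; *-cancelˡ-<;
         +-*-semiring; *-commutativeSemigroup; module ≤-Reasoning)
open import Algebra.Properties.Semiring.Sum +-*-semiring
  using (sum; sum-cong-≗; sum-replicate-zero; sum-remove; ∑-distrib-+; ∑-comm;
         *-distribˡ-sum; *-distribʳ-sum)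
open import Algebra.Properties.CommutativeSemigroup *-commutativeSemigroup
  using (x∙yz≈y∙xz; xy∙z≈xz∙y)
open import Data.Nat.Tactic.RingSolver using (solve-∀)
open import Data.Product using (Σ; ∃; _×_; _,_; proj₁; proj₂)
open import Data.Sum using ([_,_]′)
open import Function.Base using (_∘_; _on_; id)
open import Function.Bundles using (_⇔_; Equivalence; mk⇔)
open import Function.Construct.Composition using (injective)
open import Function.Definitions using (Injective)
open import Level using (Level)
open import Relation.Binary.PropositionalEquality
  using (_≡_; _≢_; refl; sym; trans; cong; cong₂; subst; module ≡-Reasoning)
open import Relation.Nullary using (Dec; yes; no; ¬_; contradiction)
open import Relation.Nullary.Decidable using (¬?; _×-dec_)
open import Relation.Unary using (Pred; Decidable)

open import Defs using (∑; EdgeColouring; col; edges; colourCount; Rainbow)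

private
  variable
    p q : Level
    n : ℕ
    P : Set p
    Q : Set q

𝟙 : Dec P → ℕ
𝟙 (yes _) = 1
𝟙 (no _) = 0

𝟙≤1 : (p : Dec P) → 𝟙 p ≤ 1
𝟙≤1 (yes _) = s≤s z≤n
𝟙≤1 (no _) = z≤n

𝟙-yes : (p : Dec P) → P → 𝟙 p ≡ 1
𝟙-yes (yes _) _ = refl
𝟙-yes (no ¬x) x = contradiction x ¬x

𝟙-no : (p : Dec P) → ¬ P → 𝟙 p ≡ 0
𝟙-no (yes x) ¬x = contradiction x ¬x
𝟙-no (no _) _ = refl

𝟙-⇔ : (p : Dec P) (q : Dec Q) → P ⇔ Q → 𝟙 p ≡ 𝟙 q
𝟙-⇔ (yes _) (yes _) _ = refl
𝟙-⇔ (yes x) (no ¬y) P⇔Q = contradiction (Equivalence.to P⇔Q x) ¬y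
𝟙-⇔ (no ¬x) (yes y) P⇔Q = contradiction (Equivalence.from P⇔Q y) ¬x
𝟙-⇔ (no _) (no _) _ = refl

𝟙-mono : (p : Dec P) (q : Dec Q) → (P → Q) → 𝟙 p ≤ 𝟙 q
𝟙-mono (yes x) (no ¬y) P→Q = contradiction (P→Q x) ¬y
𝟙-mono (yes _) (yes _) _ = ≤-refl
𝟙-mono (no _) q _ = z≤n

𝟙-× : (p : Dec P) (q : Dec Q) → 𝟙 (p ×-dec q) ≡ 𝟙 p * 𝟙 q
𝟙-× (yes _) (yes _) = refl
𝟙-× (yes _) (no _) = refl
𝟙-× (no _) q = refl

𝟙-¬ : (p : Dec P) → 𝟙 (¬? p) + 𝟙 p ≡ 1
𝟙-¬ (yes _) = refl
𝟙-¬ (no _) = refl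

𝟙*-mono-≤ : ∀ {m n} (p : Dec P) → (P → m ≤ n) → 𝟙 p * m ≤ 𝟙 p * n
𝟙*-mono-≤ (yes x) m≤n = *-monoʳ-≤ 1 (m≤n x)
𝟙*-mono-≤ (no _) _ = z≤n

∑≡sum : ∀ {k} (f : Fin k → ℕ) → ∑ f ≡ sum f
∑≡sum {zero} f = refl
∑≡sum {suc k} f = cong (f zero +_) (∑≡sum (f ∘ suc))

sum-const-1 : ∀ n → sum {n} (λ _ → 1) ≡ n
sum-const-1 zero = refl
sum-const-1 (suc n) = cong suc (sum-const-1 n)

sum-cong : {f g : Fin n → ℕ} → (∀ i → f i ≡ g i) → sum f ≡ sum g
sum-cong = sum-cong-≗

sum-zero : {f : Fin n → ℕ} → (∀ i → f i ≡ 0) → sum f ≡ 0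
sum-zero {n} f≗0 = trans (sum-cong f≗0) (sum-replicate-zero n)

sum-mono-≤ : {f g : Fin n → ℕ} → (∀ i → f i ≤ g i) → sum f ≤ sum g
sum-mono-≤ {zero} _ = z≤n
sum-mono-≤ {suc n} f≤g = +-mono-≤ (f≤g zero) (sum-mono-≤ (f≤g ∘ suc))

≤-sum : (f : Fin n → ℕ) (i : Fin n) → f i ≤ sum f
≤-sum {suc n} f i = ≤-trans (m≤m+n (f i) _) (≤-reflexive (sym (sum-remove f)))

sum-two : (f : Fin n → ℕ) {i j : Fin n} → i ≢ j → f i + f j ≤ sum f
sum-two {suc n} f {i} {j} i≢j = begin
  f i + f j                                      ≡⟨ cong (λ x → f i + f x) (sym (punchIn-punchOut i≢j)) ⟩
  f i + f (punchIn i (punchOut i≢j))             ≤⟨ +-monoʳ-≤ (f i) (≤-sum (f ∘ punchIn i) _) ⟩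
  f i + sum (f ∘ punchIn i)                      ≡⟨ sym (sum-remove f) ⟩
  sum f                                          ∎
  where open ≤-Reasoning

sum-δ : (f : Fin n → ℕ) (i : Fin n) → sum (λ j → f j * 𝟙 (i ≟ j)) ≡ f i
sum-δ {suc n} f i = begin
  sum (λ j → f j * 𝟙 (i ≟ j))
    ≡⟨ sum-remove {i = i} (λ j → f j * 𝟙 (i ≟ j)) ⟩
  f i * 𝟙 (i ≟ i) + sum (λ j → f (punchIn i j) * 𝟙 (i ≟ punchIn i j))
    ≡⟨ cong₂ _+_ (cong (f i *_) (𝟙-yes (i ≟ i) refl))
                 (sum-zero (λ j → trans (cong (f (punchIn i j) *_) (𝟙-no (i ≟ _) (punchInᵢ≢i i j ∘ sym)))
                                         (*-zeroʳ (f (punchIn i j))))) ⟩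
  f i * 1 + 0
    ≡⟨ trans (+-identityʳ _) (*-identityʳ _) ⟩
  f i ∎
  where open ≡-Reasoning

sum-𝟙≟ : (i : Fin n) → sum (λ j → 𝟙 (i ≟ j)) ≡ 1
sum-𝟙≟ i = trans (sum-cong (λ j → sym (*-identityˡ (𝟙 (i ≟ j))))) (sum-δ (λ _ → 1) i)

𝟙≢ : Fin n → Fin n → ℕ
𝟙≢ x v = 𝟙 (¬? (x ≟ v))

sum-punchIn : (g : Fin (suc n) → ℕ) (v : Fin (suc n)) →
  sum (g ∘ punchIn v) ≡ sum (λ x → 𝟙≢ x v * g x)
sum-punchIn g v = sym (begin
  sum (λ x → 𝟙≢ x v * g x)
    ≡⟨ sum-remove {i = v} (λ x → 𝟙≢ x v * g x) ⟩
  𝟙≢ v v * g v + sum (λ a → 𝟙≢ (punchIn v a) v * g (punchIn v a))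
    ≡⟨ cong₂ _+_ (cong (_* g v) (𝟙-no (¬? (v ≟ v)) (λ v≢v → v≢v refl)))
                 (sum-cong (λ a → trans (cong (_* g (punchIn v a)) (𝟙-yes (¬? (_ ≟ v)) (punchInᵢ≢i v a)))
                                        (*-identityˡ (g (punchIn v a))))) ⟩
  sum (g ∘ punchIn v) ∎)
  where open ≡-Reasoning

sum² : (Fin n → Fin n → ℕ) → ℕ
sum² F = sum (λ a → sum (F a))

sum²-cong : {F G : Fin n → Fin n → ℕ} → (∀ a b → F a b ≡ G a b) → sum² F ≡ sum² G
sum²-cong F≗G = sum-cong (λ a → sum-cong (F≗G a))

sum²-mono-≤ : {F G : Fin n → Fin n → ℕ} → (∀ a b → F a b ≤ G a b) → sum² F ≤ sum² G
sum²-mono-≤ F≤G = sum-mono-≤ (λ a → sum-mono-≤ (F≤G a))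

sum²-distrib-+ : (F G : Fin n → Fin n → ℕ) → sum² (λ a b → F a b + G a b) ≡ sum² F + sum² G
sum²-distrib-+ F G = trans (sum-cong (λ a → ∑-distrib-+ (F a) (G a)))
                           (∑-distrib-+ (λ a → sum (F a)) (λ a → sum (G a)))

*-distribˡ-sum² : ∀ c (F : Fin n → Fin n → ℕ) → c * sum² F ≡ sum² (λ a b → c * F a b)
*-distribˡ-sum² c F = trans (*-distribˡ-sum c (λ a → sum (F a)))
                            (sum-cong (λ a → *-distribˡ-sum c (F a)))

*-distribʳ-sum² : ∀ c (F : Fin n → Fin n → ℕ) → sum² F * c ≡ sum² (λ a b → F a b * c)
*-distribʳ-sum² c F = trans (*-distribʳ-sum c (λ a → sum (F a)))
                            (sum-cong (λ a → *-distribʳ-sum c (F a)))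

sum-sum²-comm : ∀ {k} (F : Fin k → Fin n → Fin n → ℕ) →
  sum (λ v → sum² (F v)) ≡ sum² (λ a b → sum (λ v → F v a b))
sum-sum²-comm F = trans (∑-comm (λ v a → sum (F v a))) (sum-cong (λ a → ∑-comm (λ v → F v a)))

≤-sum² : (F : Fin n → Fin n → ℕ) (a b : Fin n) → F a b ≤ sum² F
≤-sum² F a b = ≤-trans (≤-sum (F a) b) (≤-sum (λ a → sum (F a)) a)

sum²-two : (F : Fin n → Fin n → ℕ) {a b a' b' : Fin n} → ¬ (a ≡ a' × b ≡ b') →
  F a b + F a' b' ≤ sum² F
sum²-two F {a} {b} {a'} {b'} ≢ with a ≟ a'
... | yes refl = ≤-trans (sum-two (F a) (λ b≡b' → ≢ (refl , b≡b'))) (≤-sum (λ a → sum (F a)) a)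
... | no a≢a' = ≤-trans (+-mono-≤ (≤-sum (F a) b) (≤-sum (F a') b')) (sum-two (λ a → sum (F a)) a≢a')

sum²-δ : (F : Fin n → Fin n → ℕ) (a b : Fin n) →
  sum² (λ a' b' → F a' b' * 𝟙 (a ≟ a' ×-dec b ≟ b')) ≡ F a b
sum²-δ F a b = begin
  sum² (λ a' b' → F a' b' * 𝟙 (a ≟ a' ×-dec b ≟ b'))
    ≡⟨ sum²-cong (λ a' b' → trans (cong (F a' b' *_) (𝟙-× (a ≟ a') (b ≟ b')))
                                  (sym (*-assoc (F a' b') (𝟙 (a ≟ a')) _))) ⟩
  sum² (λ a' b' → F a' b' * 𝟙 (a ≟ a') * 𝟙 (b ≟ b'))
    ≡⟨ sum-cong (λ a' → trans (sum-cong (λ b' → xy∙z≈xz∙y (F a' b') _ _))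
                              (sym (*-distribʳ-sum (𝟙 (a ≟ a')) (λ b' → F a' b' * 𝟙 (b ≟ b'))))) ⟩
  sum (λ a' → sum (λ b' → F a' b' * 𝟙 (b ≟ b')) * 𝟙 (a ≟ a'))
    ≡⟨ sum-cong (λ a' → cong (_* 𝟙 (a ≟ a')) (sum-δ (F a') b)) ⟩
  sum (λ a' → F a' b * 𝟙 (a ≟ a'))   ≡⟨ sum-δ (λ a' → F a' b) a ⟩
  F a b                              ∎
  where open ≡-Reasoning

sum²-punchIn : (G : Fin (suc n) → Fin (suc n) → ℕ) (v : Fin (suc n)) →
  sum² (λ a b → G (punchIn v a) (punchIn v b)) ≡ sum² (λ x y → 𝟙≢ x v * (𝟙≢ y v * G x y))
sum²-punchIn G v = begin
  sum (λ a → sum (λ b → G (punchIn v a) (punchIn v b)))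
    ≡⟨ sum-cong (λ a → sum-punchIn (G (punchIn v a)) v) ⟩
  sum (λ a → sum (λ y → 𝟙≢ y v * G (punchIn v a) y))
    ≡⟨ sum-punchIn (λ x → sum (λ y → 𝟙≢ y v * G x y)) v ⟩
  sum (λ x → 𝟙≢ x v * sum (λ y → 𝟙≢ y v * G x y))
    ≡⟨ sum-cong (λ x → *-distribˡ-sum (𝟙≢ x v) (λ y → 𝟙≢ y v * G x y)) ⟩
  sum (λ x → sum (λ y → 𝟙≢ x v * (𝟙≢ y v * G x y))) ∎
  where open ≡-Reasoning

∃-*≤sum : (f : Fin (suc n) → ℕ) → ∃ λ v → suc n * f v ≤ sum f
∃-*≤sum {zero} f = zero , ≤-refl
∃-*≤sum {suc n} f with ∃-*≤sum (f ∘ suc)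
... | v , n*fv≤ with f zero ≤? f (suc v)
...   | yes f0≤fv = zero , +-monoʳ-≤ (f zero) (≤-trans (*-monoʳ-≤ (suc n) f0≤fv) n*fv≤)
...   | no f0≰fv = suc v , +-mono-≤ (<⇒≤ (≰⇒> f0≰fv)) n*fv≤

three-avoiders : {p q r : Fin n} → p ≢ q → p ≢ r → q ≢ r →
  sum (λ v → 𝟙≢ p v * (𝟙≢ q v * 𝟙≢ r v)) ≡ n ∸ 3
three-avoiders {n} {p} {q} {r} p≢q p≢r q≢r = begin
  T                                  ≡⟨ sym (m+n∸n≡m T 3) ⟩
  T + 3 ∸ 3                          ≡⟨ cong (_∸ 3) T+3≡n ⟩
  n ∸ 3                              ∎
  where
  open ≡-Reasoning
  A : Fin n → ℕ
  A v = 𝟙≢ p v * (𝟙≢ q v * 𝟙≢ r v)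
  T : ℕ
  T = sum A
  partition : ∀ v → A v + (𝟙 (p ≟ v) + (𝟙 (q ≟ v) + 𝟙 (r ≟ v))) ≡ 1
  partition v with p ≟ v | q ≟ v | r ≟ v
  ... | yes refl | yes refl | _        = contradiction refl p≢q
  ... | yes refl | _        | yes refl = contradiction refl p≢r
  ... | _        | yes refl | yes refl = contradiction refl q≢r
  ... | yes _    | no _     | no _     = refl
  ... | no _     | yes _    | no _     = refl
  ... | no _     | no _     | yes _    = refl
  ... | no _     | no _     | no _     = refl
  δ : Fin n → Fin n → ℕ
  δ x v = 𝟙 (x ≟ v)
  T+3≡n : T + 3 ≡ n
  T+3≡n = begin
    T + 3
      ≡⟨ cong (T +_) (sym (cong₂ _+_ (sum-𝟙≟ p) (cong₂ _+_ (sum-𝟙≟ q) (sum-𝟙≟ r)))) ⟩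
    T + (sum (δ p) + (sum (δ q) + sum (δ r)))
      ≡⟨ cong (λ t → T + (sum (δ p) + t)) (sym (∑-distrib-+ (δ q) (δ r))) ⟩
    T + (sum (δ p) + sum (λ v → δ q v + δ r v))
      ≡⟨ cong (T +_) (sym (∑-distrib-+ (δ p) _)) ⟩
    T + sum (λ v → δ p v + (δ q v + δ r v))
      ≡⟨ sym (∑-distrib-+ A _) ⟩
    sum (λ v → A v + (δ p v + (δ q v + δ r v)))
      ≡⟨ sum-cong partition ⟩
    sum {n} (λ _ → 1)
      ≡⟨ sum-const-1 n ⟩
    n ∎

three-avoiders-≤ : {p q r : Fin n} → p ≢ q → p ≢ r → q ≢ r → (g : Fin n → ℕ) → (∀ v → g v ≤ 1) →
  sum (λ v → 𝟙≢ p v * (𝟙≢ q v * (g v * 𝟙≢ r v))) ≤ n ∸ 3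
three-avoiders-≤ {n} {p} {q} {r} p≢q p≢r q≢r g g≤1 = begin
  sum (λ v → 𝟙≢ p v * (𝟙≢ q v * (g v * 𝟙≢ r v)))
    ≤⟨ sum-mono-≤ (λ v → *-monoʳ-≤ (𝟙≢ p v) (*-monoʳ-≤ (𝟙≢ q v)
         (≤-trans (*-monoˡ-≤ (𝟙≢ r v) (g≤1 v)) (≤-reflexive (*-identityˡ (𝟙≢ r v)))))) ⟩
  sum (λ v → 𝟙≢ p v * (𝟙≢ q v * 𝟙≢ r v))           ≡⟨ three-avoiders p≢q p≢r q≢r ⟩
  n ∸ 3                                             ∎
  where open ≤-Reasoning

IsRainbow : ∀ {k} → (Fin n → Fin n → Fin k) → Set
IsRainbow χ = ∀ a b a' b' → a Fin.< b → a' Fin.< b' → χ a b ≡ χ a' b' → a ≡ a' × b ≡ b'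

module _ {k} (χ : Fin n → Fin n → Fin k) (a b a' b' : Fin n) where

  SameColour : Set
  SameColour = a Fin.< b × a' Fin.< b' × χ a b ≡ χ a' b'

  Clash : Set
  Clash = SameColour × ¬ (a ≡ a' × b ≡ b')

  sameColour? : Dec SameColour
  sameColour? = a <? b ×-dec a' <? b' ×-dec χ a b ≟ χ a' b'

  clash? : Dec Clash
  clash? = sameColour? ×-dec ¬? (a ≟ a' ×-dec b ≟ b')

clashes : ∀ {k} → (Fin n → Fin n → Fin k) → ℕ
clashes χ = sum² λ a b → sum² λ a' b' → 𝟙 (clash? χ a b a' b')

clashes<2⇒rainbow : ∀ {k} (χ : Fin n → Fin n → Fin k) → clashes χ < 2 → IsRainbow χ
clashes<2⇒rainbow {n} χ clashes<2 a b a' b' a<b a'<b' same with a ≟ a' ×-dec b ≟ b'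
... | yes equal = equal
... | no distinct = contradiction two-clashes (<⇒≱ clashes<2)
  where
  open ≤-Reasoning
  G : Fin n → Fin n → ℕ
  G a b = sum² (λ a' b' → 𝟙 (clash? χ a b a' b'))
  two-clashes : 2 ≤ clashes χ
  two-clashes = begin
    2                                                   ≡⟨ sym (cong₂ _+_
      (𝟙-yes (clash? χ a b a' b') ((a<b , a'<b' , same) , distinct))
      (𝟙-yes (clash? χ a' b' a b) ((a'<b' , a<b , sym same) , λ (p , q) → distinct (sym p , sym q)))) ⟩
    𝟙 (clash? χ a b a' b') + 𝟙 (clash? χ a' b' a b)    ≤⟨ +-mono-≤ (≤-sum² _ a' b') (≤-sum² _ a b) ⟩
    G a b + G a' b'                                     ≤⟨ sum²-two G distinct ⟩
    clashes χ                                           ∎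

punchIn-mono-< : (v : Fin (suc n)) {a b : Fin n} → a Fin.< b → punchIn v a Fin.< punchIn v b
punchIn-mono-< v {a} {b} a<b =
  Finₚ.≤∧≢⇒< (Finₚ.punchIn-mono-≤ v a b (<⇒≤ a<b)) (Finₚ.<⇒≢ a<b ∘ punchIn-injective v a b)

clash-punchIn : ∀ {k} (χ : Fin (suc n) → Fin (suc n) → Fin k) (v : Fin (suc n)) {a b a' b' : Fin n} →
  Clash (χ on punchIn v) a b a' b' →
  Clash χ (punchIn v a) (punchIn v b) (punchIn v a') (punchIn v b')
clash-punchIn χ v ((a<b , a'<b' , same) , distinct) =
  (punchIn-mono-< v a<b , punchIn-mono-< v a'<b' , same) ,
  λ (p , q) → distinct (punchIn-injective v _ _ p , punchIn-injective v _ _ q)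

clashes-punchIn-≤ : ∀ {k} (χ : Fin (suc n) → Fin (suc n) → Fin k) (v : Fin (suc n)) →
  clashes (χ on punchIn v) ≤
  sum² λ x y → sum² λ z w → 𝟙≢ x v * (𝟙≢ y v * (𝟙≢ z v * (𝟙≢ w v * 𝟙 (clash? χ x y z w))))
clashes-punchIn-≤ {n} χ v = begin
  clashes (χ on punchIn v)
    ≤⟨ sum²-mono-≤ (λ a b → sum²-mono-≤ (λ a' b' →
         𝟙-mono (clash? (χ on punchIn v) a b a' b') (clash? χ _ _ _ _) (clash-punchIn χ v))) ⟩
  sum² (λ a b → sum² (λ a' b' → c (punchIn v a) (punchIn v b) (punchIn v a') (punchIn v b')))
    ≡⟨ sum²-cong (λ a b → sum²-punchIn (c (punchIn v a) (punchIn v b)) v) ⟩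
  sum² (λ a b → sum² (λ z w → 𝟙≢ z v * (𝟙≢ w v * c (punchIn v a) (punchIn v b) z w)))
    ≡⟨ sum²-punchIn (λ x y → sum² (λ z w → 𝟙≢ z v * (𝟙≢ w v * c x y z w))) v ⟩
  sum² (λ x y → 𝟙≢ x v * (𝟙≢ y v * sum² (λ z w → 𝟙≢ z v * (𝟙≢ w v * c x y z w))))
    ≡⟨ sum²-cong (λ x y →
         trans (cong (𝟙≢ x v *_) (*-distribˡ-sum² (𝟙≢ y v) (λ z w → 𝟙≢ z v * (𝟙≢ w v * c x y z w))))
               (*-distribˡ-sum² (𝟙≢ x v) (λ z w → 𝟙≢ y v * (𝟙≢ z v * (𝟙≢ w v * c x y z w))))) ⟩
  sum² (λ x y → sum² (λ z w → 𝟙≢ x v * (𝟙≢ y v * (𝟙≢ z v * (𝟙≢ w v * c x y z w))))) ∎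
  where
  open ≤-Reasoning
  c : (x y z w : Fin (suc n)) → ℕ
  c x y z w = 𝟙 (clash? χ x y z w)

-- Two distinct edges span at least three vertices.
clash-avoiders-≤ : ∀ {k} (χ : Fin n → Fin n → Fin k) {x y z w : Fin n} → Clash χ x y z w →
  sum (λ v → 𝟙≢ x v * (𝟙≢ y v * (𝟙≢ z v * 𝟙≢ w v))) ≤ n ∸ 3
clash-avoiders-≤ χ {x} {y} {z} {w} ((x<y , z<w , _) , distinct) with x ≟ z
... | yes refl = three-avoiders-≤ (Finₚ.<⇒≢ x<y) (Finₚ.<⇒≢ z<w) (λ y≡w → distinct (refl , y≡w))
                   (𝟙≢ x) (λ _ → 𝟙≤1 _)
... | no x≢z with y ≟ z
...   | yes refl = three-avoiders-≤ (Finₚ.<⇒≢ x<y) (Finₚ.<⇒≢ (Finₚ.<-trans x<y z<w)) (Finₚ.<⇒≢ z<w)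
                     (𝟙≢ y) (λ _ → 𝟙≤1 _)
...   | no y≢z = ≤-trans
  (≤-reflexive (sum-cong (λ v → cong (λ t → 𝟙≢ x v * (𝟙≢ y v * t)) (*-comm (𝟙≢ z v) (𝟙≢ w v)))))
  (three-avoiders-≤ (Finₚ.<⇒≢ x<y) x≢z y≢z (𝟙≢ w) (λ _ → 𝟙≤1 _))

sum-clashes-punchIn-≤ : ∀ {k} (χ : Fin (suc n) → Fin (suc n) → Fin k) →
  sum (λ v → clashes (χ on punchIn v)) ≤ (suc n ∸ 3) * clashes χ
sum-clashes-punchIn-≤ {n} χ = begin
  sum (λ v → clashes (χ on punchIn v))
    ≤⟨ sum-mono-≤ (clashes-punchIn-≤ χ) ⟩
  sum (λ v → sum² (λ x y → sum² (λ z w → D v x y z w)))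
    ≡⟨ trans (sum-sum²-comm (λ v x y → sum² (D v x y)))
             (sum²-cong (λ x y → sum-sum²-comm (λ v → D v x y))) ⟩
  sum² (λ x y → sum² (λ z w → sum (λ v → D v x y z w)))
    ≤⟨ sum²-mono-≤ (λ x y → sum²-mono-≤ (λ z w → deleted-≤ x y z w)) ⟩
  sum² (λ x y → sum² (λ z w → (suc n ∸ 3) * c x y z w))
    ≡⟨ sym (trans (*-distribˡ-sum² (suc n ∸ 3) (λ x y → sum² (c x y)))
                  (sum²-cong (λ x y → *-distribˡ-sum² (suc n ∸ 3) (c x y)))) ⟩
  (suc n ∸ 3) * clashes χ ∎
  where
  open ≤-Reasoning
  c : (x y z w : Fin (suc n)) → ℕ
  c x y z w = 𝟙 (clash? χ x y z w)
  avoiders : (x y z w v : Fin (suc n)) → ℕ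
  avoiders x y z w v = 𝟙≢ x v * (𝟙≢ y v * (𝟙≢ z v * 𝟙≢ w v))
  D : (v x y z w : Fin (suc n)) → ℕ
  D v x y z w = 𝟙≢ x v * (𝟙≢ y v * (𝟙≢ z v * (𝟙≢ w v * c x y z w)))
  deleted-≤ : ∀ x y z w → sum (λ v → D v x y z w) ≤ (suc n ∸ 3) * c x y z w
  deleted-≤ x y z w = begin
    sum (λ v → D v x y z w)
      ≡⟨ sum-cong (λ v → factor-out (𝟙≢ x v) (𝟙≢ y v) (𝟙≢ z v) (𝟙≢ w v) (c x y z w)) ⟩
    sum (λ v → c x y z w * avoiders x y z w v) ≡⟨ sym (*-distribˡ-sum (c x y z w) (avoiders x y z w)) ⟩
    c x y z w * sum (avoiders x y z w)        ≤⟨ 𝟙*-mono-≤ (clash? χ x y z w) (clash-avoiders-≤ χ) ⟩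
    c x y z w * (suc n ∸ 3)                   ≡⟨ *-comm (c x y z w) _ ⟩
    (suc n ∸ 3) * c x y z w                   ∎
    where
    factor-out : ∀ a b c d e → a * (b * (c * (d * e))) ≡ e * (a * (b * (c * d)))
    factor-out = solve-∀

n*n≡n+2*nC2 : ∀ n → n * n ≡ n + 2 * (n C 2)
n*n≡n+2*nC2 zero = refl
n*n≡n+2*nC2 (suc n) = begin
  suc n * suc n                     ≡⟨ expand n ⟩
  n * n + suc (2 * n)               ≡⟨ cong (_+ suc (2 * n)) (n*n≡n+2*nC2 n) ⟩
  n + 2 * (n C 2) + suc (2 * n)     ≡⟨ collect n (n C 2) ⟩
  suc n + 2 * (n + n C 2)           ≡⟨ cong (λ t → suc n + 2 * (t + n C 2)) (sym (nC1≡n n)) ⟩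
  suc n + 2 * (n C 1 + n C 2)       ≡⟨ cong (λ t → suc n + 2 * t) (nCk+nC[k+1]≡[n+1]C[k+1] n 1) ⟩
  suc n + 2 * (suc n C 2)           ∎
  where
  open ≡-Reasoning
  expand : ∀ n → suc n * suc n ≡ n * n + suc (2 * n)
  expand = solve-∀
  collect : ∀ n c → n + 2 * c + suc (2 * n) ≡ suc n + 2 * (n + c)
  collect = solve-∀

edgeCount : ℕ → ℕ
edgeCount n = sum² {n} (λ a b → 𝟙 (a <? b))

module _ {k} (χ : Fin n → Fin n → Fin k) where

  colourClassSize : Fin k → ℕ
  colourClassSize i = sum² (λ a b → 𝟙 (a <? b) * 𝟙 (χ a b ≟ i))

  sameColourPairs : ℕ
  sameColourPairs = sum² λ a b → sum² λ a' b' → 𝟙 (sameColour? χ a b a' b')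

  sum-colourClassSize : sum colourClassSize ≡ edgeCount n
  sum-colourClassSize = begin
    sum colourClassSize
      ≡⟨ sum-sum²-comm (λ i a b → 𝟙 (a <? b) * 𝟙 (χ a b ≟ i)) ⟩
    sum² (λ a b → sum (λ i → 𝟙 (a <? b) * 𝟙 (χ a b ≟ i)))
      ≡⟨ sum²-cong (λ a b → sym (*-distribˡ-sum (𝟙 (a <? b)) (λ i → 𝟙 (χ a b ≟ i)))) ⟩
    sum² (λ a b → 𝟙 (a <? b) * sum (λ i → 𝟙 (χ a b ≟ i)))
      ≡⟨ sum²-cong (λ a b → trans (cong (𝟙 (a <? b) *_) (sum-𝟙≟ (χ a b))) (*-identityʳ _)) ⟩
    edgeCount n ∎
    where open ≡-Reasoning

  sum-colourClassSize² : sum (λ i → colourClassSize i * colourClassSize i) ≡ sameColourPairs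
  sum-colourClassSize² = begin
    sum (λ i → colourClassSize i * colourClassSize i)
      ≡⟨ sum-cong (λ i → trans (*-distribʳ-sum² (colourClassSize i) (t i))
                               (sum²-cong (λ a b → *-distribˡ-sum² (t i a b) (t i)))) ⟩
    sum (λ i → sum² (λ a b → sum² (λ a' b' → t i a b * t i a' b')))
      ≡⟨ trans (sum-sum²-comm (λ i a b → sum² (λ a' b' → t i a b * t i a' b')))
               (sum²-cong (λ a b → sum-sum²-comm (λ i a' b' → t i a b * t i a' b'))) ⟩
    sum² (λ a b → sum² (λ a' b' → sum (λ i → t i a b * t i a' b')))
      ≡⟨ sum²-cong (λ a b → sum²-cong (λ a' b' → same-colour a b a' b')) ⟩
    sameColourPairs ∎
    where
    open ≡-Reasoning
    t : Fin k → Fin n → Fin n → ℕ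
    t i a b = 𝟙 (a <? b) * 𝟙 (χ a b ≟ i)
    same-colour : ∀ a b a' b' → sum (λ i → t i a b * t i a' b') ≡ 𝟙 (sameColour? χ a b a' b')
    same-colour a b a' b' = begin
      sum (λ i → t i a b * t i a' b')
        ≡⟨ sum-cong (λ i → regroup (𝟙 (a <? b)) (𝟙 (χ a b ≟ i)) (𝟙 (a' <? b')) (𝟙 (χ a' b' ≟ i))) ⟩
      sum (λ i → 𝟙 (a <? b) * (𝟙 (a' <? b') * 𝟙 (χ a b ≟ i)) * 𝟙 (χ a' b' ≟ i))
        ≡⟨ sum-δ (λ i → 𝟙 (a <? b) * (𝟙 (a' <? b') * 𝟙 (χ a b ≟ i))) (χ a' b') ⟩
      𝟙 (a <? b) * (𝟙 (a' <? b') * 𝟙 (χ a b ≟ χ a' b'))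
        ≡⟨ sym (trans (𝟙-× (a <? b) _) (cong (𝟙 (a <? b) *_) (𝟙-× (a' <? b') _))) ⟩
      𝟙 (sameColour? χ a b a' b') ∎
      where
      regroup : ∀ e c e' c' → e * c * (e' * c') ≡ e * (e' * c) * c'
      regroup = solve-∀

  sameColourPairs≡clashes+edgeCount : sameColourPairs ≡ clashes χ + edgeCount n
  sameColourPairs≡clashes+edgeCount = begin
    sameColourPairs
      ≡⟨ sum²-cong (λ a b → sum²-cong (λ a' b' → split a b a' b')) ⟩
    sum² (λ a b → sum² (λ a' b' → c a b a' b' + d a b a' b'))
      ≡⟨ trans (sum²-cong (λ a b → sum²-distrib-+ (c a b) (d a b)))
               (sum²-distrib-+ (λ a b → sum² (c a b)) (λ a b → sum² (d a b))) ⟩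
    clashes χ + sum² (λ a b → sum² (d a b))
      ≡⟨ cong (clashes χ +_) (sum²-cong (λ a b → trans (sum²-δ (s a b) a b) (diagonal a b))) ⟩
    clashes χ + edgeCount n ∎
    where
    open ≡-Reasoning
    s c d : Fin n → Fin n → Fin n → Fin n → ℕ
    s a b a' b' = 𝟙 (sameColour? χ a b a' b')
    c a b a' b' = 𝟙 (clash? χ a b a' b')
    d a b a' b' = s a b a' b' * 𝟙 (a ≟ a' ×-dec b ≟ b')
    split : ∀ a b a' b' → s a b a' b' ≡ c a b a' b' + d a b a' b'
    split a b a' b' = begin
      s a b a' b'                                    ≡⟨ sym (*-identityʳ _) ⟩
      s a b a' b' * 1                                ≡⟨ cong (s a b a' b' *_) (sym (𝟙-¬ eq?)) ⟩
      s a b a' b' * (𝟙 (¬? eq?) + 𝟙 eq?)             ≡⟨ *-distribˡ-+ (s a b a' b') _ _ ⟩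
      s a b a' b' * 𝟙 (¬? eq?) + s a b a' b' * 𝟙 eq?
        ≡⟨ cong (_+ s a b a' b' * 𝟙 eq?) (sym (𝟙-× (sameColour? χ a b a' b') (¬? eq?))) ⟩
      c a b a' b' + d a b a' b'                      ∎
      where
      eq? : Dec (a ≡ a' × b ≡ b')
      eq? = a ≟ a' ×-dec b ≟ b'
    diagonal : ∀ a b → s a b a b ≡ 𝟙 (a <? b)
    diagonal a b = 𝟙-⇔ (sameColour? χ a b a b) (a <? b)
      (mk⇔ (λ (a<b , _) → a<b) (λ a<b → a<b , a<b , refl))

  clashes≡2*sumC2 : clashes χ ≡ 2 * sum (λ i → colourClassSize i C 2)
  clashes≡2*sumC2 = +-cancelʳ-≡ (edgeCount n) (clashes χ) (2 * sum (λ i → K i C 2)) (begin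
    clashes χ + edgeCount n                ≡⟨ sym sameColourPairs≡clashes+edgeCount ⟩
    sameColourPairs                        ≡⟨ sym sum-colourClassSize² ⟩
    sum (λ i → K i * K i)                  ≡⟨ sum-cong (λ i → n*n≡n+2*nC2 (K i)) ⟩
    sum (λ i → K i + 2 * (K i C 2))        ≡⟨ ∑-distrib-+ K _ ⟩
    sum K + sum (λ i → 2 * (K i C 2))
      ≡⟨ cong₂ _+_ sum-colourClassSize (sym (*-distribˡ-sum 2 (λ i → K i C 2))) ⟩
    edgeCount n + 2 * sum (λ i → K i C 2)  ≡⟨ +-comm (edgeCount n) _ ⟩
    2 * sum (λ i → K i C 2) + edgeCount n  ∎)
    where
    open ≡-Reasoning
    K : Fin k → ℕ
    K = colourClassSize

length-filter-concatMap : ∀ {A B : Set} {P : Pred B p} (P? : Decidable P) (f : A → List B) (g : Fin n → A) →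
  length (filter P? (concatMap f (tabulate g))) ≡ sum (λ i → length (filter P? (f (g i))))
length-filter-concatMap {n = zero} P? f g = refl
length-filter-concatMap {n = suc n} P? f g = begin
  length (filter P? (f (g zero) ++ concatMap f (tabulate (g ∘ suc))))
    ≡⟨ cong length (filter-++ P? (f (g zero)) _) ⟩
  length (filter P? (f (g zero)) ++ filter P? (concatMap f (tabulate (g ∘ suc))))
    ≡⟨ length-++ (filter P? (f (g zero))) ⟩
  length (filter P? (f (g zero))) + length (filter P? (concatMap f (tabulate (g ∘ suc))))
    ≡⟨ cong (length (filter P? (f (g zero))) +_) (length-filter-concatMap P? f (g ∘ suc)) ⟩
  sum (λ i → length (filter P? (f (g i))))
    ∎
  where open ≡-Reasoning

-- edges builds its per-pair lists with a local function; unification recovers it here.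
edgesByVertex : ∀ n → Σ (Fin n → Fin n → List (Fin n × Fin n)) λ E →
  edges n ≡ concatMap (λ u → concatMap (E u) (allFin n)) (allFin n)
edgesByVertex n = _ , refl

edgesAt : ∀ n → Fin n → Fin n → List (Fin n × Fin n)
edgesAt n = proj₁ (edgesByVertex n)

length-filter-edgesAt : {P : Pred (Fin n × Fin n) p} (P? : Decidable P) (u v : Fin n) →
  length (filter P? (edgesAt n u v)) ≡ 𝟙 (u <? v) * 𝟙 (P? (u , v))
length-filter-edgesAt P? u v with u <? v
... | no _ = refl
... | yes _ with P? (u , v)
...   | yes _ = refl
...   | no _ = refl

colourCount≡colourClassSize : ∀ {k} (c : EdgeColouring n k) (i : Fin k) →
  colourCount c i ≡ colourClassSize (col c) i
colourCount≡colourClassSize {n} c i = begin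
  length (filter Q? (concatMap (λ u → concatMap (edgesAt n u) (allFin n)) (allFin n)))
    ≡⟨ length-filter-concatMap Q? (λ u → concatMap (edgesAt n u) (allFin n)) id ⟩
  sum (λ u → length (filter Q? (concatMap (edgesAt n u) (allFin n))))
    ≡⟨ sum-cong (λ u → length-filter-concatMap Q? (edgesAt n u) id) ⟩
  sum² (λ u v → length (filter Q? (edgesAt n u v)))
    ≡⟨ sum²-cong (length-filter-edgesAt Q?) ⟩
  colourClassSize (col c) i ∎
  where
  open ≡-Reasoning
  Q? : Decidable (λ (e : Fin n × Fin n) → col c (proj₁ e) (proj₂ e) ≡ i)
  Q? (u , v) = col c u v ≟ i

falling₃ : ℕ → ℕ
falling₃ s = s * (s ∸ 1) * (s ∸ 2)

falling₃-descent : ∀ {M P P'} s → 3 ≤ s → M * P < 2 * falling₃ (suc s) → suc s * P' ≤ (s ∸ 2) * P →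
  M * P' < 2 * falling₃ s
falling₃-descent {M} {P} {P'} s@(suc (suc (suc t))) (s≤s (s≤s (s≤s _))) M*P< s+1*P'≤ =
  *-cancelˡ-< (suc s) (M * P') (2 * falling₃ s) (begin-strict
    suc s * (M * P')                   ≡⟨ x∙yz≈y∙xz (suc s) M P' ⟩
    M * (suc s * P')                   ≤⟨ *-monoʳ-≤ M s+1*P'≤ ⟩
    M * (suc t * P)                    ≡⟨ x∙yz≈y∙xz M (suc t) P ⟩
    suc t * (M * P)                    <⟨ *-monoʳ-< (suc t) M*P< ⟩
    suc t * (2 * falling₃ (suc s))     ≡⟨ shift t ⟩
    suc s * (2 * falling₃ s)           ∎)
  where
  open ≤-Reasoning
  shift : ∀ t → suc t * (2 * ((4 + t) * (3 + t) * (2 + t))) ≡ (4 + t) * (2 * ((3 + t) * (2 + t) * (1 + t)))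
  shift = solve-∀

module _ {k m : ℕ} (3≤m : 3 ≤ m) where

  SparseRestriction : ∀ s → (Fin s → Fin s → Fin k) → Set
  SparseRestriction s χ = Σ (Fin m → Fin s) λ f → Injective _≡_ _≡_ f × clashes (χ on f) < 2

  sparse-restriction : ∀ s (χ : Fin s → Fin s → Fin k) → m ≤ s →
    falling₃ m * clashes χ < 2 * falling₃ s → SparseRestriction s χ

  sparse-restriction-≡ : ∀ s (χ : Fin s → Fin s → Fin k) →
    falling₃ m * clashes χ < 2 * falling₃ s → m ≡ s → SparseRestriction s χ
  sparse-restriction-≡ s χ bound refl =
    id , id ,
    *-cancelˡ-< (falling₃ m) (clashes χ) 2 (subst (falling₃ m * clashes χ <_) (*-comm 2 (falling₃ m)) bound)

  sparse-restriction-< : ∀ s (χ : Fin s → Fin s → Fin k) →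
    falling₃ m * clashes χ < 2 * falling₃ s → m < s → SparseRestriction s χ
  sparse-restriction-< (suc s) χ bound (s≤s m≤s) =
    let v , v-below-average = ∃-*≤sum (λ v → clashes (χ on punchIn v))
        v-good : suc s * clashes (χ on punchIn v) ≤ (s ∸ 2) * clashes χ
        v-good = ≤-trans v-below-average (sum-clashes-punchIn-≤ χ)
        f , f-injective , f-clashes = sparse-restriction s (χ on punchIn v) m≤s
          (falling₃-descent {M = falling₃ m} s (≤-trans 3≤m m≤s) bound v-good)
    -- f and g are given explicitly: inferring them would unfold the recursive call.
    in punchIn v ∘ f ,
       injective _≡_ _≡_ _≡_ {f = f} {g = punchIn v} f-injective (punchIn-injective v _ _) ,
       f-clashes

  sparse-restriction s χ m≤s bound =
    [ sparse-restriction-< s χ bound , sparse-restriction-≡ s χ bound ]′ (m≤n⇒m<n∨m≡n m≤s)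

few-clashes⇒rainbow : ∀ {k m} (c : EdgeColouring n k) → 3 ≤ m → m ≤ n →
  falling₃ m * clashes (col c) < 2 * falling₃ n → Rainbow c m
few-clashes⇒rainbow {n} c 3≤m m≤n bound =
  let f , f-injective , f-clashes = sparse-restriction 3≤m n (col c) m≤n bound
  in f , f-injective , clashes<2⇒rainbow (col c on f) f-clashes

lemma3p1 : (n m k : ℕ) → 3 ≤ m → m ≤ n → 1 ≤ k → (e : Fin k → ℕ) →
    ∑ e ≡ n C 2 →
    m * (m ∸ 1) * (m ∸ 2) * ∑ (λ i → e i C 2) < n * (n ∸ 1) * (n ∸ 2) →
    (c : EdgeColouring n k) → (∀ i → colourCount c i ≡ e i) →
    Rainbow c m
lemma3p1 n m k 3≤m m≤n _ e _ few-monochromatic-pairs c counts =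
  few-clashes⇒rainbow c 3≤m m≤n initial
  where
  open ≤-Reasoning
  clashes≡ : clashes (col c) ≡ 2 * ∑ (λ i → e i C 2)
  clashes≡ = begin-equality
    clashes (col c)                                  ≡⟨ clashes≡2*sumC2 (col c) ⟩
    2 * sum (λ i → colourClassSize (col c) i C 2)    ≡⟨ cong (2 *_) (sum-cong (λ i → cong (_C 2)
                                                          (trans (sym (colourCount≡colourClassSize c i)) (counts i)))) ⟩
    2 * sum (λ i → e i C 2)                          ≡⟨ cong (2 *_) (sym (∑≡sum (λ i → e i C 2))) ⟩
    2 * ∑ (λ i → e i C 2)                            ∎
  initial : falling₃ m * clashes (col c) < 2 * falling₃ n
  initial = begin-strict
    falling₃ m * clashes (col c)                     ≡⟨ cong (falling₃ m *_) clashes≡ ⟩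
    falling₃ m * (2 * ∑ (λ i → e i C 2))             ≡⟨ x∙yz≈y∙xz (falling₃ m) 2 _ ⟩
    2 * (falling₃ m * ∑ (λ i → e i C 2))             <⟨ *-monoʳ-< 2 few-monochromatic-pairs ⟩
    2 * falling₃ n                                   ∎
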